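{- Every $1$-contracting automaton $\mathscr{A}=(Q,\Sigma,\delta)$ with $n$ states admits an efficient $1$-contracting collection, i.e. a $1$-contracting collection $W$ with $|w|\le n$ for all $w\in W$.
   Context: A DFA is $\mathscr{A}=(Q,\Sigma,\delta)$ with finite state set $Q$ ($|Q|=n$), finite alphabet $\Sigma$ and transition function $\delta:Q\times\Sigma\to Q$, extended to words in the usual way and to subsets by $\delta(S,w)=\{\delta(q,w)\mid q\in S\}$. A word $w$ is a $1$-deficient word excluding $q$ if $\delta(Q,w)=Q\setminus\{q\}$. A collection $W\subseteq\Sigma^\star$ is a $1$-contracting collection if for every $q\in Q$ it contains exactly one $1$-deficient word excluding $q$; $\mathscr{A}$ is $1$-contracting if such a collection exists. The collection is efficient if all its words have length at most $n$. -}

module Defs where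

open import Data.Nat using (ℕ; _≤_)
open import Data.Fin using (Fin)
open import Data.List using (List; []; _∷_; length)
open import Data.Product using (∃; _×_)
open import Relation.Nullary using (¬_)
open import Relation.Binary.PropositionalEquality using (_≡_; _≢_)

DFA : ℕ → ℕ → Set
DFA n m = Fin n → Fin m → Fin n

δ* : ∀ {n m} → DFA n m → Fin n → List (Fin m) → Fin n
δ* δ q []       = q
δ* δ q (a ∷ w) = δ* δ (δ q a) w

InImage : ∀ {n m} → DFA n m → List (Fin m) → Fin n → Set
InImage {n} δ w p = ∃ λ (r : Fin n) → δ* δ r w ≡ p

Deficient1 : ∀ {n m} → DFA n m → List (Fin m) → Fin n → Set
Deficient1 {n} δ w q = ((p : Fin n) → p ≢ q → InImage δ w p) × ¬ InImage δ w q

-- A 1-contracting collection, presented as the choice q ↦ W q of the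
-- (unique) word of the collection excluding q.
Contracting1Collection : ∀ {n m} → DFA n m → (Fin n → List (Fin m)) → Set
Contracting1Collection {n} δ W = (q : Fin n) → Deficient1 δ (W q) q

IsContracting1 : ∀ {n m} → DFA n m → Set
IsContracting1 {n} {m} δ = ∃ λ (W : Fin n → List (Fin m)) → Contracting1Collection δ W

Efficient : ∀ {n m} → (Fin n → List (Fin m)) → Set
Efficient {n} W = (q : Fin n) → length (W q) ≤ n

module Submission where

-- Let w be a 1-deficient word excluding q with |w| > n, and
-- split it as w = u v.  The image δ(Q, u v) = δ(δ(Q, u), v) covers the
-- n - 1 states of Q ∖ {q}, so choosing a preimage of each of them gives an
-- injection from an (n - 1)-element set into δ(Q, u): the image of every
-- prefix u misses at most one state.  Its "shape" (full, or missing p)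
-- therefore takes at most n + 1 values, while w has at least n + 2 prefixes.
-- By pigeonhole two prefixes u = w[0,i) and u' = w[0,j), i < j, have the
-- same image, and cutting out w[i,j) gives a strictly shorter word with the
-- same image as w.  Iterating yields a word of length ≤ n for every q.

open import Defs
open import Data.Nat using (ℕ; zero; suc; _≤_; _<_; z≤n; s≤s; _≤?_)
open import Data.Nat.Properties using (≤-trans; ≤-refl; ≰⇒>; ≤-pred; m≤n⇒m≤1+n; 1+n≰n)
open import Data.Fin using (Fin; punchIn; punchOut; toℕ; _≟_)
open import Data.Fin.Properties using (any?; all?; ¬∀⟶∃¬; pigeonhole; injective⇒≤; punchIn-injective; punchInᵢ≢i; punchOut-injective; toℕ<n)
open import Data.List using (List; []; _∷_; length; take; drop; _++_)
open import Data.List.Properties using (take++drop≡id)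
open import Data.Product using (Σ; ∃; _×_; _,_; proj₁; proj₂)
open import Data.Empty using (⊥; ⊥-elim)
open import Function.Definitions using (Injective)
open import Relation.Nullary using (¬_; Dec; yes; no)
open import Relation.Binary.PropositionalEquality using (_≡_; _≢_; refl; sym; trans; cong; subst)

punchOut-injection : ∀ {k n} (f : Fin k → Fin (suc n)) → Injective _≡_ _≡_ f →
  (p : Fin (suc n)) (avoids : ∀ i → p ≢ f i) →
  Injective _≡_ _≡_ (λ i → punchOut (avoids i))
punchOut-injection f f-inj p avoids eq = f-inj (punchOut-injective (avoids _) (avoids _) eq)

injection-misses-at-most-one : ∀ {k} (f : Fin k → Fin (suc k)) → Injective _≡_ _≡_ f →
  ∀ p₁ p₂ → p₁ ≢ p₂ → (∀ i → p₁ ≢ f i) → (∀ i → p₂ ≢ f i) → ⊥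
injection-misses-at-most-one {zero} f f-inj Fin.zero Fin.zero p₁≢p₂ _ _ = p₁≢p₂ refl
injection-misses-at-most-one {suc k} f f-inj p₁ p₂ p₁≢p₂ avoids₁ avoids₂ =
  1+n≰n (injective⇒≤ (punchOut-injection g g-inj (punchOut p₁≢p₂) g-avoids))
  where
  g : Fin (suc k) → Fin (suc k)
  g i = punchOut (avoids₁ i)
  g-inj : Injective _≡_ _≡_ g
  g-inj = punchOut-injection f f-inj p₁ avoids₁
  g-avoids : ∀ i → punchOut p₁≢p₂ ≢ g i
  g-avoids i eq = avoids₂ i (punchOut-injective p₁≢p₂ (avoids₁ i) eq)

punctured-injection-misses-at-most-one : ∀ {n} (q : Fin n) (f : ∀ r → r ≢ q → Fin n) →
  (∀ r r' r≢q r'≢q → f r r≢q ≡ f r' r'≢q → r ≡ r') →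
  ∀ p₁ p₂ → p₁ ≢ p₂ → (∀ r r≢q → p₁ ≢ f r r≢q) → (∀ r r≢q → p₂ ≢ f r r≢q) → ⊥
punctured-injection-misses-at-most-one {suc k} q f f-inj p₁ p₂ p₁≢p₂ avoids₁ avoids₂ =
  injection-misses-at-most-one g g-inj p₁ p₂ p₁≢p₂ (λ _ → avoids₁ _ _) (λ _ → avoids₂ _ _)
  where
  g : Fin k → Fin (suc k)
  g i = f (punchIn q i) (punchInᵢ≢i q i)
  g-inj : Injective _≡_ _≡_ g
  g-inj {i} {j} eq = punchIn-injective q i j (f-inj _ _ _ _ eq)

drop-shorter : ∀ {A : Set} b (w : List A) → suc b ≤ length w → length (drop (suc b) w) < length w
drop-shorter zero    (x ∷ w) _          = ≤-refl
drop-shorter (suc b) (x ∷ w) (s≤s b<∣w∣) = m≤n⇒m≤1+n (drop-shorter b w b<∣w∣)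

cut-shorter : ∀ {A : Set} a b (w : List A) → a < b → b ≤ length w →
  length (take a w ++ drop b w) < length w
cut-shorter zero    (suc b) w       _         b≤∣w∣       = drop-shorter b w b≤∣w∣
cut-shorter (suc a) (suc b) (x ∷ w) (s≤s a<b) (s≤s b≤∣w∣) = s≤s (cut-shorter a b w a<b b≤∣w∣)

δ*-++ : ∀ {n m} (δ : DFA n m) s u v → δ* δ s (u ++ v) ≡ δ* δ (δ* δ s u) v
δ*-++ δ s []      v = refl
δ*-++ δ s (a ∷ u) v = δ*-++ δ (δ s a) u v

module Images {n m : ℕ} (δ : DFA n m) where

  Word : Set
  Word = List (Fin m)

  _⊆_ : Word → Word → Set
  u ⊆ u' = ∀ p → InImage δ u p → InImage δ u' p

  InImage? : ∀ u p → Dec (InImage δ u p)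
  InImage? u p = any? (λ r → δ* δ r u ≟ p)

  -- Since δ(Q, u v) = δ(δ(Q, u), v), inclusion of images survives appending.
  ++-mono : ∀ u u' v → u ⊆ u' → (u ++ v) ⊆ (u' ++ v)
  ++-mono u u' v u⊆u' p (s , s↦p) with u⊆u' (δ* δ s u) (s , refl)
  ... | s' , s'↦ = s' , trans (δ*-++ δ s' u' v)
                          (trans (cong (λ t → δ* δ t v) s'↦) (trans (sym (δ*-++ δ s u v)) s↦p))

  same-image-deficient : ∀ w w' q → w ⊆ w' → w' ⊆ w → Deficient1 δ w' q → Deficient1 δ w q
  same-image-deficient w w' q w⊆w' w'⊆w (covers , misses) =
    (λ p p≢q → w'⊆w p (covers p p≢q)) , (λ q∈w → misses (w⊆w' _ q∈w))

  MissesAtMostOne : Word → Set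
  MissesAtMostOne u = ∀ p₁ p₂ → p₁ ≢ p₂ → ¬ InImage δ u p₁ → ¬ InImage δ u p₂ → ⊥

  -- If u v is 1-deficient, δ(Q, u) misses at most one state: a preimage
  -- of each state r ≢ q gives an injection Q ∖ {q} → δ(Q, u), since
  -- reading v maps it back onto r.
  prefix-misses-at-most-one : ∀ {q} u v → Deficient1 δ (u ++ v) q → MissesAtMostOne u
  prefix-misses-at-most-one {q} u v (covers , _) p₁ p₂ p₁≢p₂ p₁∉u p₂∉u =
    punctured-injection-misses-at-most-one q f f-inj p₁ p₂ p₁≢p₂
      (λ r r≢q p₁≡ → p₁∉u (source r r≢q , sym p₁≡)) (λ r r≢q p₂≡ → p₂∉u (source r r≢q , sym p₂≡))
    where
    source : ∀ r → r ≢ q → Fin n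
    source r r≢q = proj₁ (covers r r≢q)
    f : ∀ r → r ≢ q → Fin n
    f r r≢q = δ* δ (source r r≢q) u
    f-then-v : ∀ r r≢q → δ* δ (f r r≢q) v ≡ r
    f-then-v r r≢q = trans (sym (δ*-++ δ (source r r≢q) u v)) (proj₂ (covers r r≢q))
    f-inj : ∀ r r' r≢q r'≢q → f r r≢q ≡ f r' r'≢q → r ≡ r'
    f-inj r r' r≢q r'≢q eq =
      trans (sym (f-then-v r r≢q)) (trans (cong (λ t → δ* δ t v) eq) (f-then-v r' r'≢q))

  -- The shape of an image missing at most one state, coded in Fin (suc n):
  -- zero for δ(Q, u) = Q, suc p for δ(Q, u) = Q ∖ {p}.
  HasShape : Word → Fin (suc n) → Set
  HasShape u Fin.zero    = ∀ p → InImage δ u p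
  HasShape u (Fin.suc p) = Deficient1 δ u p

  shape : ∀ u → MissesAtMostOne u → Σ (Fin (suc n)) (HasShape u)
  shape u at-most-one with all? (InImage? u)
  ... | yes full = Fin.zero , full
  ... | no ¬full with ¬∀⟶∃¬ n (InImage δ u) (InImage? u) ¬full
  ... | p , p∉u = Fin.suc p , covers , p∉u
    where
    covers : ∀ r → r ≢ p → InImage δ u r
    covers r r≢p with InImage? u r
    ... | yes r∈u = r∈u
    ... | no r∉u = ⊥-elim (at-most-one p r (λ p≡r → r≢p (sym p≡r)) p∉u r∉u)

  same-shape⇒⊆ : ∀ u u' c → HasShape u c → HasShape u' c → u ⊆ u'
  same-shape⇒⊆ u u' Fin.zero    _          full'         r _   = full' r
  same-shape⇒⊆ u u' (Fin.suc p) (_ , p∉u) (covers' , _) r r∈u =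
    covers' r (λ r≡p → p∉u (subst (InImage δ u) r≡p r∈u))

  split-deficient : ∀ {q} w k → Deficient1 δ w q → Deficient1 δ (take k w ++ drop k w) q
  split-deficient {q} w k = subst (λ x → Deficient1 δ x q) (sym (take++drop≡id k w))

  prefix-shape : ∀ {q} w → Deficient1 δ w q → ∀ k → Σ (Fin (suc n)) (HasShape (take k w))
  prefix-shape w w-def k =
    shape (take k w) (prefix-misses-at-most-one (take k w) (drop k w) (split-deficient w k w-def))

  cut-deficient : ∀ {q} w i j (w-def : Deficient1 δ w q) →
    proj₁ (prefix-shape w w-def i) ≡ proj₁ (prefix-shape w w-def j) →
    Deficient1 δ (take i w ++ drop j w) q
  cut-deficient {q} w i j w-def same =
    same-image-deficient (take i w ++ drop j w) (take j w ++ drop j w) q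
      (++-mono (take i w) (take j w) (drop j w) u⊆u') (++-mono (take j w) (take i w) (drop j w) u'⊆u)
      (split-deficient w j w-def)
    where
    c : Fin (suc n)
    c = proj₁ (prefix-shape w w-def j)
    u-shape : HasShape (take i w) c
    u-shape = subst (HasShape (take i w)) same (proj₂ (prefix-shape w w-def i))
    u⊆u' : take i w ⊆ take j w
    u⊆u' = same-shape⇒⊆ (take i w) (take j w) c u-shape (proj₂ (prefix-shape w w-def j))
    u'⊆u : take j w ⊆ take i w
    u'⊆u = same-shape⇒⊆ (take j w) (take i w) c (proj₂ (prefix-shape w w-def j)) u-shape

  -- A 1-deficient word longer than n has a strictly shorter 1-deficient
  -- word excluding the same state: two of its n + 2 prefixes of length
  -- ≤ n + 1 share a shape, and the factor between them is cut out.
  shorten : ∀ q w → Deficient1 δ w q → n < length w →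
    Σ Word λ w' → Deficient1 δ w' q × length w' < length w
  shorten q w w-def n<∣w∣ with pigeonhole ≤-refl (λ i → proj₁ (prefix-shape w w-def (toℕ i)))
  ... | i , j , i<j , same =
    take (toℕ i) w ++ drop (toℕ j) w ,
    cut-deficient w (toℕ i) (toℕ j) w-def same ,
    cut-shorter (toℕ i) (toℕ j) w i<j (≤-trans (≤-pred (toℕ<n j)) n<∣w∣)

  efficient-word : ∀ q k w → length w ≤ k → Deficient1 δ w q →
    Σ Word λ w' → Deficient1 δ w' q × length w' ≤ n
  efficient-word q zero w ∣w∣≤0 w-def = w , w-def , ≤-trans ∣w∣≤0 z≤n
  efficient-word q (suc k) w ∣w∣≤k w-def with length w ≤? n
  ... | yes ∣w∣≤n = w , w-def , ∣w∣≤n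
  ... | no ∣w∣≰n = continue (shorten q w w-def (≰⇒> ∣w∣≰n))
    where
    continue : (Σ Word λ w' → Deficient1 δ w' q × length w' < length w) →
      Σ Word λ w' → Deficient1 δ w' q × length w' ≤ n
    continue (w' , w'-def , shorter) = efficient-word q k w' (≤-pred (≤-trans shorter ∣w∣≤k)) w'-def

lemma1 : (n m : ℕ) (δ : DFA n m) → IsContracting1 δ →
    ∃ λ (W : Fin n → List (Fin m)) → Contracting1Collection δ W × Efficient W
lemma1 n m δ (W , W-contracting) =
  (λ q → proj₁ (short q)) , (λ q → proj₁ (proj₂ (short q))) , (λ q → proj₂ (proj₂ (short q)))
  where
  short : ∀ q → Σ (List (Fin m)) λ w → Deficient1 δ w q × length w ≤ n
  short q = Images.efficient-word δ q (length (W q)) (W q) ≤-refl (W-contracting q)
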